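{- Let $\mathsf M$ be a $k$-generic matroid on $[n]$ ($k\ge0$), $\Bbbk$ a field, and $i_0\in[n]$ any element. Then $\mathcal R^p(\mathsf M\setminus\{i_0\})\subseteq\mathcal R^p(\mathsf M)$ for all $0\le p\le k$, where $V(\mathsf M\setminus\{i_0\})$ is identified with the coordinate hyperplane $\{x_{i_0}=0\}$ of $\Bbbk^n$.
   Context: A matroid is $k$-generic if it has no circuits of size $k+1$ or smaller. $\mathsf M\setminus\{i_0\}$ is the deletion of $i_0$, a matroid on $[n]\setminus\{i_0\}$. For a matroid $\mathsf N$ on a finite set $S$: $V(\mathsf N)=\Bbbk^S$ with basis $\{e_s\}$, $E=\Lambda(V(\mathsf N))$, $\partial$ the graded derivation with $\partial(e_s)=1$, $e_C=\prod_{s\in C}e_s$; $A(\mathsf N)=E/I$ with $I$ generated by $\partial(e_C)$ over circuits $C$; $\mathcal R^p(\mathsf N)=\{v\in V(\mathsf N):H^p(A(\mathsf N),\cdot v)\ne0\}$, where $(A(\mathsf N),\cdot v)$ is the cochain complex with differential $x\mapsto xv$. -}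

module Defs where

open import Level using (Level; suc; _⊔_)
open import Algebra.Bundles using (CommutativeRing)
open import Data.Nat as ℕ using (ℕ; zero; _<_; _≤_)
import Data.Nat
open import Data.Bool using (Bool; true; false; if_then_else_)
open import Data.Fin using (Fin; _<?_)
open import Data.Fin.Subset using (Subset; ⁅_⁆; _∈_; _⊆_; _∪_; _∩_; ∣_∣; ⊥; Empty) renaming (_-_ to _∖_)
open import Data.Fin.Subset.Properties using (_∈?_)
open import Data.Vec using (Vec; []; _∷_; insertAt)
import Data.Vec.Functional as VF
open import Data.Vec.Properties using (≡-dec)
open import Data.Bool.Properties using () renaming (_≟_ to _≟B_)
import Data.List.Relation.Unary.All
open import Data.List using (List; []; _∷_; _++_; map; foldr; concatMap; length; filter)
open import Data.List.Base using (allFin)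
open import Data.Product using (Σ; _×_; _,_; ∃)
open import Relation.Nullary using (¬_; Dec; yes; no)
open import Relation.Nullary.Decidable using (⌊_⌋; _×-dec_)
open import Relation.Binary.PropositionalEquality using (_≡_; _≢_)

record Field (c ℓ : Level) : Set (suc (c ⊔ ℓ)) where
  field
    commutativeRing : CommutativeRing c ℓ
  open CommutativeRing commutativeRing public
  field
    1≉0     : ¬ (1# ≈ 0#)
    inverse : ∀ x → ¬ (x ≈ 0#) → Σ Carrier λ y → (x * y) ≈ 1#

_≟S_ : ∀ {n} (S T : Subset n) → Dec (S ≡ T)
_≟S_ = ≡-dec _≟B_

record Matroid (n : ℕ) : Set₁ where
  field
    IsCircuit   : Subset n → Set
    empty-not   : ¬ IsCircuit ⊥
    incomparable : ∀ C D → IsCircuit C → IsCircuit D → C ⊆ D → C ≡ D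
    elimination : ∀ C D (e : Fin n) → IsCircuit C → IsCircuit D → C ≢ D →
                  e ∈ C → e ∈ D →
                  Σ (Subset n) λ F → IsCircuit F × (F ⊆ ((C ∪ D) ∖ e))

IsGeneric : ∀ {n} → ℕ → Matroid n → Set
IsGeneric k M = ∀ C → Matroid.IsCircuit M C → Data.Nat.suc k < ∣ C ∣

CircuitFamily : ℕ → Set₁
CircuitFamily n = Subset n → Set

-- Deletion M \ {i0}: ground set [n+1] ∖ {i0}, identified with Fin n via
-- punchIn i0 (the subset S ⊆ Fin n corresponds to insertAt S i0 false).
deletionCircuits : ∀ {m} → Matroid (Data.Nat.suc m) → Fin (Data.Nat.suc m) → CircuitFamily m
deletionCircuits M i0 C = Matroid.IsCircuit M (insertAt C i0 false)

module _ {c ℓ} (F : Field c ℓ) where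
  open Field F

  allSubsets : ∀ n → List (Subset n)
  allSubsets zero = [] ∷ []
  allSubsets (Data.Nat.suc n) = map (true ∷_) (allSubsets n) ++ map (false ∷_) (allSubsets n)

  sumL : List Carrier → Carrier
  sumL = foldr _+_ 0#

  -- elements of E: coefficient functions on the monomial basis {e_S}
  Ext : ℕ → Set c
  Ext n = Subset n → Carrier

  _≈E_ : ∀ {n} → Ext n → Ext n → Set ℓ
  x ≈E y = ∀ S → x S ≈ y S

  zeroE : ∀ {n} → Ext n
  zeroE _ = 0#

  _+E_ : ∀ {n} → Ext n → Ext n → Ext n
  (x +E y) S = x S + y S

  _·E_ : ∀ {n} → Carrier → Ext n → Ext n
  (a ·E x) S = a * x S

  -E_ : ∀ {n} → Ext n → Ext n
  (-E x) S = - (x S)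

  sumE : ∀ {n} → List (Ext n) → Ext n
  sumE = foldr _+E_ zeroE

  -- monomial e_S = e_{s1} ∧ ... ∧ e_{sr}  (s1 < ... < sr)
  e : ∀ {n} → Subset n → Ext n
  e S T with S ≟S T
  ... | yes _ = 1#
  ... | no  _ = 0#

  sgn : ℕ → Carrier
  sgn zero = 1#
  sgn (Data.Nat.suc k) = - (sgn k)

  inversions : ∀ {n} → Subset n → Subset n → ℕ
  inversions {n} S T =
    length (filter (λ st → ((Data.Product.proj₁ st ∈? S) ×-dec (Data.Product.proj₂ st ∈? T))
                             ×-dec (Data.Product.proj₂ st <? Data.Product.proj₁ st))
      (concatMap (λ s → map (s ,_) (allFin n)) (allFin n)))

  monoMul : ∀ {n} → Subset n → Subset n → Ext n
  monoMul S T with (S ∩ T) ≟S ⊥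
  ... | yes _ = sgn (inversions S T) ·E e (S ∪ T)
  ... | no  _ = zeroE

  _∧_ : ∀ {n} → Ext n → Ext n → Ext n
  _∧_ {n} x y = sumE (concatMap (λ S → map (λ T → (x S * y T) ·E monoMul S T)
                                          (allSubsets n)) (allSubsets n))

  below : ∀ {n} → Subset n → Fin n → ℕ
  below {n} S s = length (filter (λ t → (t ∈? S) ×-dec (t <? s)) (allFin n))

  -- the graded derivation ∂ with ∂(e_s) = 1, on monomials:
  -- ∂(e_{s1}∧…∧e_{sr}) = Σ_j (-1)^{j-1} e_{s1}∧…∧ê_{sj}∧…∧e_{sr}
  ∂e : ∀ {n} → Subset n → Ext n
  ∂e {n} S = sumE (map (λ s → if ⌊ s ∈? S ⌋ then sgn (below S s) ·E e (S ∖ s) else zeroE)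
                       (allFin n))

  -- membership in the ideal I ⊆ E generated by ∂(e_C), C a circuit
  -- (E is graded-commutative and the generators are homogeneous, so
  -- left, right and two-sided ideals coincide)
  InIdeal : ∀ {n} → CircuitFamily n → Ext n → Set (c ⊔ ℓ)
  InIdeal {n} Circ x =
    Σ (List (Ext n × Subset n)) λ gens →
      Data.List.Relation.Unary.All.All (λ g → Circ (Data.Product.proj₂ g)) gens ×
      (x ≈E sumE (map (λ g → Data.Product.proj₁ g ∧ ∂e (Data.Product.proj₂ g)) gens))

  HomogeneousOf : ∀ {n} → ℕ → Ext n → Set ℓ
  HomogeneousOf p x = ∀ S → ∣ S ∣ ≢ p → x S ≈ 0#

  toExt : ∀ {n} → (Fin n → Carrier) → Ext n
  toExt {n} v = sumE (map (λ s → v s ·E e ⁅ s ⁆) (allFin n))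

  -- H^p(A(N), ·v) ≠ 0 : there is a class of degree p in A = E/I which is a
  -- cocycle (x·v = 0 in A) but not a coboundary (x ∉ A^{p-1}·v in A).
  -- Degree p-1 for p = 0 is empty: y is then forced to be 0.
  Resonant : ∀ {n} → CircuitFamily n → ℕ → (Fin n → Carrier) → Set (c ⊔ ℓ)
  Resonant {n} Circ p v =
    Σ (Ext n) λ x → HomogeneousOf p x ×
      InIdeal Circ (x ∧ toExt v) ×
      ¬ (Σ (Ext n) λ y → (∀ S → Data.Nat.suc ∣ S ∣ ≢ p → y S ≈ 0#) ×
                          InIdeal Circ (x +E (-E (y ∧ toExt v))))

  embedV : ∀ {m} → Fin (Data.Nat.suc m) → (Fin m → Carrier) → (Fin (Data.Nat.suc m) → Carrier)
  embedV i0 v = VF.insertAt v i0 0#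

-- Extension by zero along the coordinate i0 is an algebra map from the exterior algebra of
-- the deletion to that of M: inserting an element that lies in no subset preserves every
-- inversion count, hence every sign. It sends ∂(e_C) to ∂(e_C) and v to its image in the
-- hyperplane x_i0 = 0, so it maps the ideal of M ∖ i0 into the ideal of M and cocycles to
-- cocycles; restriction to the subsets avoiding i0 is a left inverse. Since M is k-generic,
-- its ideal is generated in degrees ≥ k + 1 and vanishes in degrees ≤ k. So for p ≤ k a
-- coboundary relation for the extended class modulo the ideal of M holds already in the
-- exterior algebra, and restricting it exhibits the original class as a coboundary.

module Submission where

open import Defs
open import Algebra.Bundles using (CommutativeMonoid)
open import Data.Bool using (Bool; true; false; if_then_else_)
open import Data.Empty using (⊥-elim)
open import Data.Fin as Fin using (Fin; zero; suc; punchIn; _<?_)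
open import Data.Fin.Properties using (punchIn-mono-≤; punchIn-cancel-≤)
open import Data.Fin.Subset using (Subset; ⁅_⁆; _∈_; _∉_; _∩_; _∪_; ∣_∣; ⊥) renaming (_-_ to _∖_)
open import Data.Fin.Subset.Properties using (_∈?_; p─⊥≡p; x∈⁅y⁆⇒x≡y; x∈p∪q⁻; ∣⁅x⁆∣≡1; p─q⊆p; ∣q∣≤∣p∪q∣; x∈p∪q⁺)
open import Data.List using (List; []; _∷_; _++_; map; concatMap; filter; length; tabulate; allFin)
open import Data.List.Relation.Unary.All using (All; []; _∷_)
import Data.List.Relation.Unary.All.Properties as All
open import Data.List.Properties using (filter-++; length-++; map-tabulate; map-++; map-∘; map-cong)
open import Data.Nat as ℕ using (ℕ; zero; suc; _≤_; _<_; s≤s)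
import Data.Nat.Properties as ℕ
open import Data.Product using (Σ; _×_; _,_; proj₁; proj₂)
open import Data.Product.Function.NonDependent.Propositional using (_×-⇔_)
open import Data.Sum as Sum⊎ using (_⊎_; inj₁; inj₂)
open import Data.Vec using ([]; _∷_; insertAt; removeAt; lookup; zipWith)
import Data.Vec.Functional.Properties as VF
open import Data.Vec.Properties using (insertAt-lookup; insertAt-punchIn; removeAt-insertAt; insertAt-removeAt; lookup⇒[]=; []=⇒lookup; ∷-injectiveʳ)
open import Function using (_∘_; id; _⇔_; mk⇔; Equivalence)
open import Relation.Nullary using (Dec; yes; no; does)
import Relation.Unary
open import Relation.Nullary.Decidable using (⌊_⌋; _×-dec_; does-⇔; dec-false)
import Relation.Binary.PropositionalEquality as ≡
open ≡ using (_≡_; _≢_; refl; module ≡-Reasoning)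

import Algebra.Properties.CommutativeMonoid.Sum as MonoidSum
import Algebra.Properties.CommutativeSemigroup
import Algebra.Properties.Group

private
  variable
    n : ℕ

∈-insertAt-self : (i : Fin (suc n)) (S : Subset n) → i ∈ insertAt S i true
∈-insertAt-self i S = lookup⇒[]= i _ (insertAt-lookup S i true)

∉-insertAt-self : (i : Fin (suc n)) (S : Subset n) → i ∉ insertAt S i false
∉-insertAt-self i S i∈ with () ← ≡.trans (≡.sym ([]=⇒lookup i∈)) (insertAt-lookup S i false)

punchIn∈insertAt⇔∈ : (i : Fin (suc n)) (S : Subset n) (b : Bool) (t : Fin n) →
                     punchIn i t ∈ insertAt S i b ⇔ t ∈ S
punchIn∈insertAt⇔∈ i S b t = mk⇔
  (λ t∈ → lookup⇒[]= t S (≡.trans (≡.sym (insertAt-punchIn S i b t)) ([]=⇒lookup t∈)))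
  (λ t∈ → lookup⇒[]= (punchIn i t) _ (≡.trans (insertAt-punchIn S i b t) ([]=⇒lookup t∈)))

insertAt-view : (i : Fin (suc n)) (S : Subset (suc n)) →
                (Σ (Subset n) λ T → S ≡ insertAt T i false) ⊎ i ∈ S
insertAt-view i S with lookup S i in eq
... | true  = inj₂ (lookup⇒[]= i S eq)
... | false = inj₁ (removeAt S i , ≡.trans (≡.sym (insertAt-removeAt S i)) (≡.cong (insertAt (removeAt S i) i) eq))

insertAt-injective : (i : Fin (suc n)) (b : Bool) {S T : Subset n} → insertAt S i b ≡ insertAt T i b → S ≡ T
insertAt-injective i b {S} {T} eq =
  ≡.trans (≡.sym (removeAt-insertAt S i b)) (≡.trans (≡.cong (λ U → removeAt U i) eq) (removeAt-insertAt T i b))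

zipWith-insertAt : (f : Bool → Bool → Bool) (i : Fin (suc n)) (a b : Bool) (S T : Subset n) →
                   zipWith f (insertAt S i a) (insertAt T i b) ≡ insertAt (zipWith f S T) i (f a b)
zipWith-insertAt f zero    a b S       T       = refl
zipWith-insertAt f (suc i) a b (x ∷ S) (y ∷ T) = ≡.cong (f x y ∷_) (zipWith-insertAt f i a b S T)

insertAt-⊥ : (i : Fin (suc n)) → insertAt ⊥ i false ≡ ⊥
insertAt-⊥ zero            = refl
insertAt-⊥ {suc n} (suc i) = ≡.cong (false ∷_) (insertAt-⊥ i)

insertAt≡⊥⇔≡⊥ : (i : Fin (suc n)) (S : Subset n) → insertAt S i false ≡ ⊥ ⇔ S ≡ ⊥
insertAt≡⊥⇔≡⊥ i S = mk⇔ (λ S′≡⊥ → insertAt-injective i false (≡.trans S′≡⊥ (≡.sym (insertAt-⊥ i))))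
                        (λ S≡⊥ → ≡.trans (≡.cong (λ X → insertAt X i false) S≡⊥) (insertAt-⊥ i))

insertAt-⁅⁆ : (i : Fin (suc n)) (t : Fin n) → insertAt ⁅ t ⁆ i false ≡ ⁅ punchIn i t ⁆
insertAt-⁅⁆ zero    t       = refl
insertAt-⁅⁆ (suc i) zero    = ≡.cong (true ∷_) (insertAt-⊥ i)
insertAt-⁅⁆ (suc i) (suc t) = ≡.cong (false ∷_) (insertAt-⁅⁆ i t)

insertAt-∖ : (i : Fin (suc n)) (S : Subset n) (t : Fin n) →
             insertAt S i false ∖ punchIn i t ≡ insertAt (S ∖ t) i false
insertAt-∖ zero    S       t       = refl
insertAt-∖ (suc i) (x ∷ S) zero    =
  ≡.cong (false ∷_) (≡.trans (p─⊥≡p _) (≡.cong (λ U → insertAt U i false) (≡.sym (p─⊥≡p S))))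
insertAt-∖ (suc i) (x ∷ S) (suc t) = ≡.cong (x ∷_) (insertAt-∖ i S t)

∣insertAt-false∣ : (i : Fin (suc n)) (S : Subset n) → ∣ insertAt S i false ∣ ≡ ∣ S ∣
∣insertAt-false∣ zero    S           = refl
∣insertAt-false∣ (suc i) (true ∷ S)  = ≡.cong suc (∣insertAt-false∣ i S)
∣insertAt-false∣ (suc i) (false ∷ S) = ∣insertAt-false∣ i S

∣S∣≤1+∣S∖x∣ : (S : Subset n) (x : Fin n) → ∣ S ∣ ≤ suc ∣ S ∖ x ∣
∣S∣≤1+∣S∖x∣ (true  ∷ S) zero    = ℕ.≤-reflexive (≡.cong (suc ∘ ∣_∣) (≡.sym (p─⊥≡p S)))
∣S∣≤1+∣S∖x∣ (false ∷ S) zero    =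
  ℕ.≤-trans (ℕ.n≤1+n _) (ℕ.≤-reflexive (≡.cong (suc ∘ ∣_∣) (≡.sym (p─⊥≡p S))))
∣S∣≤1+∣S∖x∣ (true  ∷ S) (suc x) = s≤s (∣S∣≤1+∣S∖x∣ S x)
∣S∣≤1+∣S∖x∣ (false ∷ S) (suc x) = ∣S∣≤1+∣S∖x∣ S x

∣S∪T∣≡∣S∣+∣T∣ : (S T : Subset n) → S ∩ T ≡ ⊥ → ∣ S ∪ T ∣ ≡ ∣ S ∣ ℕ.+ ∣ T ∣
∣S∪T∣≡∣S∣+∣T∣ []          []          _  = refl
∣S∪T∣≡∣S∣+∣T∣ (true  ∷ S) (false ∷ T) eq = ≡.cong suc (∣S∪T∣≡∣S∣+∣T∣ S T (∷-injectiveʳ eq))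
∣S∪T∣≡∣S∣+∣T∣ (false ∷ S) (true  ∷ T) eq =
  ≡.trans (≡.cong suc (∣S∪T∣≡∣S∣+∣T∣ S T (∷-injectiveʳ eq))) (≡.sym (ℕ.+-suc ∣ S ∣ ∣ T ∣))
∣S∪T∣≡∣S∣+∣T∣ (false ∷ S) (false ∷ T) eq = ∣S∪T∣≡∣S∣+∣T∣ S T (∷-injectiveʳ eq)

-- Inversion counts under insertion of a new element

punchIn-<⇔< : (i : Fin (suc n)) {s t : Fin n} → punchIn i t Fin.< punchIn i s ⇔ t Fin.< s
punchIn-<⇔< i {s} {t} = mk⇔
  (λ t′<s′ → ℕ.≰⇒> (λ s≤t → ℕ.<⇒≱ t′<s′ (punchIn-mono-≤ i s t s≤t)))
  (λ t<s → ℕ.≰⇒> (λ s′≤t′ → ℕ.<⇒≱ t<s (punchIn-cancel-≤ i s t s′≤t′)))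

indicator : Bool → ℕ
indicator true  = 1
indicator false = 0

module _ {a ℓ} (M : CommutativeMonoid a ℓ) where
  open CommutativeMonoid M
  open MonoidSum M using (sum; sum-cong-≋; sum-replicate-zero; sum-remove)

  sum-zero : (f : Fin n → Carrier) → (∀ i → f i ≈ ε) → sum f ≈ ε
  sum-zero {n} f f≈ε = trans (sum-cong-≋ f≈ε) (sum-replicate-zero n)

  sum-punchIn : (i : Fin (suc n)) (f : Fin (suc n) → Carrier) → f i ≈ ε → sum f ≈ sum (f ∘ punchIn i)
  sum-punchIn i f fi≈ε = trans (sum-remove {i = i} f) (trans (∙-congʳ fi≈ε) (identityˡ _))

private
  ℕ+ : CommutativeMonoid _ _
  ℕ+ = ℕ.+-0-commutativeMonoid

open MonoidSum ℕ+ using () renaming (sum to ∑ℕ; sum-cong-≗ to ∑ℕ-cong)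

module _ {a p} {A : Set a} {P : A → Set p} (P? : Relation.Unary.Decidable P) where

  length-filter-tabulate : (f : Fin n → A) →
    length (filter P? (tabulate f)) ≡ ∑ℕ (λ i → indicator (does (P? (f i))))
  length-filter-tabulate {zero}  f = refl
  length-filter-tabulate {suc n} f with does (P? (f zero))
  ... | true  = ≡.cong suc (length-filter-tabulate (f ∘ suc))
  ... | false = length-filter-tabulate (f ∘ suc)

  length-filter-concatMap : ∀ {b} {B : Set b} (g : B → List A) (f : Fin n → B) →
    length (filter P? (concatMap g (tabulate f))) ≡ ∑ℕ (λ i → length (filter P? (g (f i))))
  length-filter-concatMap {zero}  g f = refl
  length-filter-concatMap {suc n} g f = begin
    length (filter P? (g (f zero) ++ rest))                ≡⟨ ≡.cong length (filter-++ P? (g (f zero)) rest) ⟩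
    length (filter P? (g (f zero)) ++ filter P? rest)      ≡⟨ length-++ (filter P? (g (f zero))) ⟩
    length (filter P? (g (f zero))) ℕ.+ length (filter P? rest)
      ≡⟨ ≡.cong (length (filter P? (g (f zero))) ℕ.+_) (length-filter-concatMap g (f ∘ suc)) ⟩
    ∑ℕ (λ i → length (filter P? (g (f i))))                ∎
    where
    open ≡-Reasoning
    rest = concatMap g (tabulate (f ∘ suc))

module _ {c ℓ} (F : Field c ℓ) where

  inverted? : (S T : Subset n) (st : Fin n × Fin n) →
              Dec ((proj₁ st ∈ S × proj₂ st ∈ T) × proj₂ st Fin.< proj₁ st)
  inverted? S T st = ((proj₁ st ∈? S) ×-dec (proj₂ st ∈? T)) ×-dec (proj₂ st <? proj₁ st)

  inversions-sum : (S T : Subset n) →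
    inversions F S T ≡ ∑ℕ (λ s → ∑ℕ (λ t → indicator (does (inverted? S T (s , t)))))
  inversions-sum {n} S T = ≡.trans (length-filter-concatMap (inverted? S T) (λ s → map (s ,_) (allFin n)) id)
    (∑ℕ-cong λ s → ≡.trans (≡.cong (length ∘ filter (inverted? S T)) (map-tabulate id (s ,_)))
                           (length-filter-tabulate (inverted? S T) (s ,_)))

  inversions-insertAt : (i : Fin (suc n)) (S T : Subset n) →
    inversions F (insertAt S i false) (insertAt T i false) ≡ inversions F S T
  inversions-insertAt i S T = begin
    inversions F S′ T′
      ≡⟨ inversions-sum S′ T′ ⟩
    ∑ℕ (λ s → ∑ℕ (q′ s))
      ≡⟨ sum-punchIn ℕ+ i (∑ℕ ∘ q′) (sum-zero ℕ+ (q′ i) q′-out-left) ⟩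
    ∑ℕ (λ s → ∑ℕ (q′ (punchIn i s)))
      ≡⟨ ∑ℕ-cong (λ s → sum-punchIn ℕ+ i (q′ (punchIn i s)) (q′-out-right s)) ⟩
    ∑ℕ (λ s → ∑ℕ (λ t → q′ (punchIn i s) (punchIn i t)))
      ≡⟨ ∑ℕ-cong (λ s → ∑ℕ-cong (q′-punchIn s)) ⟩
    ∑ℕ (λ s → ∑ℕ (λ t → indicator (does (inverted? S T (s , t)))))
      ≡⟨ inversions-sum S T ⟨
    inversions F S T
      ∎
    where
    open ≡-Reasoning
    S′ = insertAt S i false
    T′ = insertAt T i false
    q′ : Fin _ → Fin _ → ℕ
    q′ s t = indicator (does (inverted? S′ T′ (s , t)))
    q′-out-left : ∀ t → q′ i t ≡ 0
    q′-out-left t = ≡.cong indicator (dec-false (inverted? S′ T′ (i , t)) (∉-insertAt-self i S ∘ proj₁ ∘ proj₁))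
    q′-out-right : ∀ s → q′ (punchIn i s) i ≡ 0
    q′-out-right s = ≡.cong indicator (dec-false (inverted? S′ T′ (punchIn i s , i)) (∉-insertAt-self i T ∘ proj₂ ∘ proj₁))
    inverted⇔ : ∀ s t → ((punchIn i s ∈ S′ × punchIn i t ∈ T′) × punchIn i t Fin.< punchIn i s)
                       ⇔ ((s ∈ S × t ∈ T) × t Fin.< s)
    inverted⇔ s t = (punchIn∈insertAt⇔∈ i S false s ×-⇔ punchIn∈insertAt⇔∈ i T false t) ×-⇔ punchIn-<⇔< i
    q′-punchIn : ∀ s t → q′ (punchIn i s) (punchIn i t) ≡ indicator (does (inverted? S T (s , t)))
    q′-punchIn s t = ≡.cong indicator
      (does-⇔ (inverted⇔ s t) (inverted? S′ T′ (punchIn i s , punchIn i t)) (inverted? S T (s , t)))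

  below? : (S : Subset n) (s t : Fin n) → Dec (t ∈ S × t Fin.< s)
  below? S s t = (t ∈? S) ×-dec (t <? s)

  below-insertAt : (i : Fin (suc n)) (S : Subset n) (s : Fin n) →
    below F (insertAt S i false) (punchIn i s) ≡ below F S s
  below-insertAt i S s = begin
    below F S′ (punchIn i s)                     ≡⟨ length-filter-tabulate (below? S′ (punchIn i s)) id ⟩
    ∑ℕ q′                                        ≡⟨ sum-punchIn ℕ+ i q′ q′-out ⟩
    ∑ℕ (q′ ∘ punchIn i)                          ≡⟨ ∑ℕ-cong q′-punchIn ⟩
    ∑ℕ (λ t → indicator (does (below? S s t)))   ≡⟨ length-filter-tabulate (below? S s) id ⟨
    below F S s                                  ∎
    where
    open ≡-Reasoning
    S′ = insertAt S i false
    q′ : Fin _ → ℕ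
    q′ t = indicator (does (below? S′ (punchIn i s) t))
    q′-out : q′ i ≡ 0
    q′-out = ≡.cong indicator (dec-false (below? S′ (punchIn i s) i) (∉-insertAt-self i S ∘ proj₁))
    below⇔ : ∀ t → (punchIn i t ∈ S′ × punchIn i t Fin.< punchIn i s) ⇔ (t ∈ S × t Fin.< s)
    below⇔ t = punchIn∈insertAt⇔∈ i S false t ×-⇔ punchIn-<⇔< i
    q′-punchIn : ∀ t → q′ (punchIn i t) ≡ indicator (does (below? S s t))
    q′-punchIn t = ≡.cong indicator (does-⇔ (below⇔ t) (below? S′ (punchIn i s) (punchIn i t)) (below? S s t))

module _ {c ℓ} (F : Field c ℓ) where
  open Field F hiding (zero) renaming (refl to ≈-refl)
  open import Relation.Binary.Reasoning.Setoid setoid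
  module FSum = MonoidSum +-commutativeMonoid
  open FSum using (sum)
  open Algebra.Properties.CommutativeSemigroup +-commutativeSemigroup using () renaming (interchange to +-interchange)
  open Algebra.Properties.Group +-group using (x∙y⁻¹≈ε⇒x≈y; x≈y⇒x∙y⁻¹≈ε)

  private
    infixl 7 _⋀_
    _⋀_ : Ext F n → Ext F n → Ext F n
    _⋀_ = _∧_ F

    infix 4 _≋_
    _≋_ : Ext F n → Ext F n → Set ℓ
    _≋_ = _≈E_ F

  sumL-map-cong : ∀ {a} {A : Set a} {f g : A → Carrier} (xs : List A) →
                  (∀ x → f x ≈ g x) → sumL F (map f xs) ≈ sumL F (map g xs)
  sumL-map-cong []       f≈g = ≈-refl
  sumL-map-cong (x ∷ xs) f≈g = +-cong (f≈g x) (sumL-map-cong xs f≈g)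

  sumL-++ : (xs ys : List Carrier) → sumL F (xs ++ ys) ≈ sumL F xs + sumL F ys
  sumL-++ []       ys = sym (+-identityˡ _)
  sumL-++ (x ∷ xs) ys = trans (+-congˡ (sumL-++ xs ys)) (sym (+-assoc _ _ _))

  sumL-map-zero : ∀ {a p} {A : Set a} {P : A → Set p} {f : A → Carrier} {xs : List A} →
                  All P xs → (∀ x → P x → f x ≈ 0#) → sumL F (map f xs) ≈ 0#
  sumL-map-zero []         f≈0 = ≈-refl
  sumL-map-zero (px ∷ pxs) f≈0 = trans (+-cong (f≈0 _ px) (sumL-map-zero pxs f≈0)) (+-identityˡ 0#)

  sumL-map-tabulate : ∀ {a} {A : Set a} (g : A → Carrier) (f : Fin n → A) → sumL F (map g (tabulate f)) ≡ sum (g ∘ f)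
  sumL-map-tabulate {zero}  g f = ≡.refl
  sumL-map-tabulate {suc n} g f = ≡.cong (g (f zero) +_) (sumL-map-tabulate g (f ∘ suc))

  sumSubsets : ∀ n → (Subset n → Carrier) → Carrier
  sumSubsets zero    f = f []
  sumSubsets (suc n) f = sumSubsets n (f ∘ (true ∷_)) + sumSubsets n (f ∘ (false ∷_))

  sumSubsets-cong : ∀ n {f g : Subset n → Carrier} → (∀ S → f S ≈ g S) → sumSubsets n f ≈ sumSubsets n g
  sumSubsets-cong zero    f≈g = f≈g []
  sumSubsets-cong (suc n) f≈g = +-cong (sumSubsets-cong n (f≈g ∘ (true ∷_))) (sumSubsets-cong n (f≈g ∘ (false ∷_)))

  sumSubsets-zero : ∀ n {f : Subset n → Carrier} → (∀ S → f S ≈ 0#) → sumSubsets n f ≈ 0#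
  sumSubsets-zero zero    f≈0 = f≈0 []
  sumSubsets-zero (suc n) f≈0 =
    trans (+-cong (sumSubsets-zero n (f≈0 ∘ (true ∷_))) (sumSubsets-zero n (f≈0 ∘ (false ∷_)))) (+-identityˡ 0#)

  sumSubsets-insertAt : (i : Fin (suc n)) (f : Subset (suc n) → Carrier) →
    sumSubsets (suc n) f ≈ sumSubsets n (λ T → f (insertAt T i false)) + sumSubsets n (λ T → f (insertAt T i true))
  sumSubsets-insertAt zero            f = +-comm _ _
  sumSubsets-insertAt {suc n} (suc i) f = trans
    (+-cong (sumSubsets-insertAt i (f ∘ (true ∷_))) (sumSubsets-insertAt i (f ∘ (false ∷_))))
    (+-interchange _ _ _ _)

  sumL-allSubsets : ∀ n (f : Subset n → Carrier) → sumL F (map f (allSubsets F n)) ≈ sumSubsets n f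
  sumL-allSubsets zero    f = +-identityʳ _
  sumL-allSubsets (suc n) f = begin
    sumL F (map f (map (true ∷_) A ++ map (false ∷_) A))
      ≡⟨ ≡.cong (sumL F) (map-++ f (map (true ∷_) A) _) ⟩
    sumL F (map f (map (true ∷_) A) ++ map f (map (false ∷_) A))
      ≈⟨ sumL-++ (map f (map (true ∷_) A)) _ ⟩
    sumL F (map f (map (true ∷_) A)) + sumL F (map f (map (false ∷_) A))
      ≡⟨ ≡.cong₂ (λ x y → sumL F x + sumL F y) (≡.sym (map-∘ A)) (≡.sym (map-∘ A)) ⟩
    sumL F (map (f ∘ (true ∷_)) A) + sumL F (map (f ∘ (false ∷_)) A)
      ≈⟨ +-cong (sumL-allSubsets n _) (sumL-allSubsets n _) ⟩
    sumSubsets (suc n) f ∎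
    where A = allSubsets F n

  sumE-map-apply : ∀ {a} {A : Set a} (g : A → Ext F n) (xs : List A) (S : Subset n) →
                   sumE F (map g xs) S ≡ sumL F (map (λ x → g x S) xs)
  sumE-map-apply g []       S = ≡.refl
  sumE-map-apply g (x ∷ xs) S = ≡.cong (g x S +_) (sumE-map-apply g xs S)

  sumE-++ : (xs ys : List (Ext F n)) (S : Subset n) → sumE F (xs ++ ys) S ≈ sumE F xs S + sumE F ys S
  sumE-++ []       ys S = sym (+-identityˡ _)
  sumE-++ (x ∷ xs) ys S = trans (+-congˡ (sumE-++ xs ys S)) (sym (+-assoc _ _ _))

  sumE-concatMap : ∀ {a} {A : Set a} (h : A → List (Ext F n)) (xs : List A) (S : Subset n) →
                   sumE F (concatMap h xs) S ≈ sumL F (map (λ x → sumE F (h x) S) xs)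
  sumE-concatMap h []       S = ≈-refl
  sumE-concatMap h (x ∷ xs) S = trans (sumE-++ (h x) (concatMap h xs) S) (+-congˡ (sumE-concatMap h xs S))

  sumE-map-cong : ∀ {a} {A : Set a} {f g : A → Ext F n} (xs : List A) →
                  (∀ x → f x ≋ g x) → sumE F (map f xs) ≋ sumE F (map g xs)
  sumE-map-cong []       f≋g S = ≈-refl
  sumE-map-cong (x ∷ xs) f≋g S = +-cong (f≋g x S) (sumE-map-cong xs f≋g S)

  e-view : (A B : Subset n) → e F A B ≈ 0# ⊎ A ≡ B
  e-view A B with A ≟S B
  ... | yes A≡B = inj₂ A≡B
  ... | no  _   = inj₁ ≈-refl

  ∧-apply : (a b : Ext F n) (S : Subset n) →
            (a ⋀ b) S ≈ sumSubsets n (λ T → sumSubsets n (λ U → (a T * b U) * monoMul F T U S))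
  ∧-apply {n} a b S = begin
    (a ⋀ b) S                                             ≈⟨ sumE-concatMap row A S ⟩
    sumL F (map (λ T → sumE F (row T) S) A)               ≡⟨ ≡.cong (sumL F) (map-cong (λ T → sumE-map-apply _ A S) A) ⟩
    sumL F (map (λ T → sumL F (map (term T) A)) A)        ≈⟨ sumL-map-cong A (λ T → sumL-allSubsets n (term T)) ⟩
    sumL F (map (λ T → sumSubsets n (term T)) A)          ≈⟨ sumL-allSubsets n _ ⟩
    sumSubsets n (λ T → sumSubsets n (term T))            ∎
    where
    A = allSubsets F n
    row : Subset n → List (Ext F n)
    row T = map (λ U → _·E_ F (a T * b U) (monoMul F T U)) A
    term : Subset n → Subset n → Carrier
    term T U = (a T * b U) * monoMul F T U S

  ∧-cong : {a a′ b b′ : Ext F n} → a ≋ a′ → b ≋ b′ → a ⋀ b ≋ a′ ⋀ b′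
  ∧-cong {n} {a} {a′} {b} {b′} a≋a′ b≋b′ S = begin
    (a ⋀ b) S    ≈⟨ ∧-apply a b S ⟩
    sumSubsets n (λ T → sumSubsets n (λ U → (a T * b U) * monoMul F T U S))
      ≈⟨ sumSubsets-cong n (λ T → sumSubsets-cong n (λ U → *-congʳ (*-cong (a≋a′ T) (b≋b′ U)))) ⟩
    sumSubsets n (λ T → sumSubsets n (λ U → (a′ T * b′ U) * monoMul F T U S))
      ≈⟨ ∧-apply a′ b′ S ⟨
    (a′ ⋀ b′) S  ∎

  monoMul-view : (T U S : Subset n) → monoMul F T U S ≈ 0# ⊎ (T ∩ U ≡ ⊥ × T ∪ U ≡ S)
  monoMul-view T U S with (T ∩ U) ≟S ⊥
  ... | no _         = inj₁ ≈-refl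
  ... | yes disjoint with e-view (T ∪ U) S
  ...   | inj₁ e≈0 = inj₁ (trans (*-congˡ e≈0) (zeroʳ _))
  ...   | inj₂ T∪U≡S = inj₂ (disjoint , T∪U≡S)

  *-zero-outer : ∀ {x y z} → x * y ≈ 0# → (x * y) * z ≈ 0#
  *-zero-outer {z = z} xy≈0 = trans (*-congʳ xy≈0) (zeroˡ z)

  ∧-vanishes : (a b : Ext F n) (S : Subset n) →
               (∀ T U → T ∩ U ≡ ⊥ → T ∪ U ≡ S → a T ≈ 0# ⊎ b U ≈ 0#) → (a ⋀ b) S ≈ 0#
  ∧-vanishes {n} a b S vanish = trans (∧-apply a b S) (sumSubsets-zero n (λ T → sumSubsets-zero n (term≈0 T)))
    where
    term≈0 : ∀ T U → (a T * b U) * monoMul F T U S ≈ 0#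
    term≈0 T U with monoMul-view T U S
    ... | inj₁ m≈0 = trans (*-congˡ m≈0) (zeroʳ _)
    ... | inj₂ (disjoint , T∪U≡S) with vanish T U disjoint T∪U≡S
    ...   | inj₁ aT≈0 = *-zero-outer (trans (*-congʳ aT≈0) (zeroˡ _))
    ...   | inj₂ bU≈0 = *-zero-outer (trans (*-congˡ bU≈0) (zeroʳ _))

  ∂term : (C : Subset n) → Fin n → Ext F n
  ∂term C s = if ⌊ s ∈? C ⌋ then _·E_ F (sgn F (below F C s)) (e F (C ∖ s)) else zeroE F

  ∂e-apply : (C U : Subset n) → ∂e F C U ≡ sum (λ s → ∂term C s U)
  ∂e-apply {n} C U = ≡.trans (sumE-map-apply (∂term C) (allFin n) U) (sumL-map-tabulate (λ s → ∂term C s U) id)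

  ∂term-view : (C : Subset n) (s : Fin n) (U : Subset n) → ∂term C s U ≈ 0# ⊎ (s ∈ C × C ∖ s ≡ U)
  ∂term-view C s U with s ∈? C
  ... | no  _   = inj₁ ≈-refl
  ... | yes s∈C with e-view (C ∖ s) U
  ...   | inj₁ e≈0   = inj₁ (trans (*-congˡ e≈0) (zeroʳ _))
  ...   | inj₂ C∖s≡U = inj₂ (s∈C , C∖s≡U)

  toExt-apply : (v : Fin n → Carrier) (U : Subset n) → toExt F v U ≡ sum (λ s → v s * e F ⁅ s ⁆ U)
  toExt-apply {n} v U = ≡.trans (sumE-map-apply (λ s → _·E_ F (v s) (e F ⁅ s ⁆)) (allFin n) U)
                                (sumL-map-tabulate (λ s → v s * e F ⁅ s ⁆ U) id)

  toExt-term-view : (v : Fin n → Carrier) (s : Fin n) (U : Subset n) → v s * e F ⁅ s ⁆ U ≈ 0# ⊎ ⁅ s ⁆ ≡ U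
  toExt-term-view v s U with e-view ⁅ s ⁆ U
  ... | inj₁ e≈0 = inj₁ (trans (*-congˡ e≈0) (zeroʳ _))
  ... | inj₂ ⁅s⁆≡U = inj₂ ⁅s⁆≡U

  -- Degrees

  toExt-homogeneous : (v : Fin n → Carrier) → HomogeneousOf F 1 (toExt F v)
  toExt-homogeneous v U ∣U∣≢1 = trans (reflexive (toExt-apply v U)) (sum-zero +-commutativeMonoid _ term≈0)
    where
    term≈0 : ∀ s → v s * e F ⁅ s ⁆ U ≈ 0#
    term≈0 s with toExt-term-view v s U
    ... | inj₁ t≈0  = t≈0
    ... | inj₂ ⁅s⁆≡U = ⊥-elim (∣U∣≢1 (≡.trans (≡.cong ∣_∣ (≡.sym ⁅s⁆≡U)) (∣⁅x⁆∣≡1 s)))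

  ∧-homogeneous : ∀ {q r} (a b : Ext F n) → (∀ T → q ℕ.+ ∣ T ∣ ≢ r → a T ≈ 0#) → HomogeneousOf F q b →
                  ∀ S → ∣ S ∣ ≢ r → (a ⋀ b) S ≈ 0#
  ∧-homogeneous {q = q} {r} a b a-hom b-hom S ∣S∣≢r = ∧-vanishes a b S vanish
    where
    vanish : ∀ T U → T ∩ U ≡ ⊥ → T ∪ U ≡ S → a T ≈ 0# ⊎ b U ≈ 0#
    vanish T U disjoint T∪U≡S with q ℕ.+ ∣ T ∣ ℕ.≟ r | ∣ U ∣ ℕ.≟ q
    ... | no  q+∣T∣≢r | _          = inj₁ (a-hom T q+∣T∣≢r)
    ... | yes _       | no ∣U∣≢q   = inj₂ (b-hom U ∣U∣≢q)
    ... | yes q+∣T∣≡r | yes ∣U∣≡q  = ⊥-elim (∣S∣≢r (≡.trans (≡.cong ∣_∣ (≡.sym T∪U≡S))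
      (≡.trans (∣S∪T∣≡∣S∣+∣T∣ T U disjoint)
      (≡.trans (≡.cong (∣ T ∣ ℕ.+_) ∣U∣≡q) (≡.trans (ℕ.+-comm ∣ T ∣ q) q+∣T∣≡r)))))

  ∂e-vanishes-low : (C U : Subset n) → suc ∣ U ∣ < ∣ C ∣ → ∂e F C U ≈ 0#
  ∂e-vanishes-low C U 1+∣U∣<∣C∣ = trans (reflexive (∂e-apply C U)) (sum-zero +-commutativeMonoid _ term≈0)
    where
    term≈0 : ∀ s → ∂term C s U ≈ 0#
    term≈0 s with ∂term-view C s U
    ... | inj₁ t≈0 = t≈0
    ... | inj₂ (_ , C∖s≡U) = ⊥-elim (ℕ.<⇒≱ 1+∣U∣<∣C∣
            (ℕ.≤-trans (∣S∣≤1+∣S∖x∣ C s) (ℕ.≤-reflexive (≡.cong (suc ∘ ∣_∣) C∖s≡U))))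

  InIdeal-vanishes-low : ∀ {Circ : CircuitFamily n} {z : Ext F n} k →
    (∀ C → Circ C → suc k < ∣ C ∣) → InIdeal F Circ z → ∀ S → ∣ S ∣ ≤ k → z S ≈ 0#
  InIdeal-vanishes-low k large (gens , circuits , z≋) S ∣S∣≤k = begin
    _                                               ≈⟨ z≋ S ⟩
    sumE F (map generator gens) S                   ≡⟨ sumE-map-apply generator gens S ⟩
    sumL F (map (λ g → generator g S) gens)         ≈⟨ sumL-map-zero circuits (λ g isC → ∧-vanishes _ _ S (∂-low g isC)) ⟩
    0#                                              ∎
    where
    generator = λ g → proj₁ g ⋀ ∂e F (proj₂ g)
    ∂-low : ∀ g → _ → ∀ T U → T ∩ U ≡ ⊥ → T ∪ U ≡ S → proj₁ g T ≈ 0# ⊎ ∂e F (proj₂ g) U ≈ 0#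
    ∂-low (_ , C) isC T U _ T∪U≡S = inj₂ (∂e-vanishes-low C U (ℕ.≤-<-trans
      (s≤s (ℕ.≤-trans (∣q∣≤∣p∪q∣ T U) (ℕ.≤-trans (ℕ.≤-reflexive (≡.cong ∣_∣ T∪U≡S)) ∣S∣≤k)))
      (large C isC)))

  InIdeal-cong : ∀ {Circ : CircuitFamily n} {z z′ : Ext F n} → z ≋ z′ → InIdeal F Circ z → InIdeal F Circ z′
  InIdeal-cong z≋z′ (gens , circuits , z≋) = gens , circuits , λ S → trans (sym (z≋z′ S)) (z≋ S)

  ≋⇒InIdeal-difference : ∀ {Circ : CircuitFamily n} {z z′ : Ext F n} → z ≋ z′ → InIdeal F Circ (_+E_ F z (-E_ F z′))
  ≋⇒InIdeal-difference z≋z′ = [] , [] , λ S → x≈y⇒x∙y⁻¹≈ε (z≋z′ S)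

  -- Restriction to and extension from the hyperplane x_i = 0

  Avoids : Fin (suc n) → Ext F (suc n) → Set ℓ
  Avoids i x = ∀ U → i ∈ U → x U ≈ 0#

  restrict : Fin (suc n) → Ext F (suc n) → Ext F n
  restrict i x T = x (insertAt T i false)

  restrict-vanishes : ∀ {p} {P : ℕ → Set p} (i : Fin (suc n)) (x : Ext F (suc n)) →
    (∀ S → P ∣ S ∣ → x S ≈ 0#) → ∀ T → P ∣ T ∣ → restrict i x T ≈ 0#
  restrict-vanishes {P = P} i x x≈0 T P∣T∣ = x≈0 (insertAt T i false) (≡.subst P (≡.sym (∣insertAt-false∣ i T)) P∣T∣)

  e-insertAt : (i : Fin (suc n)) (A B : Subset n) → e F (insertAt A i false) (insertAt B i false) ≡ e F A B
  e-insertAt i A B with insertAt A i false ≟S insertAt B i false | A ≟S B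
  ... | yes _     | yes _     = ≡.refl
  ... | no  _     | no  _     = ≡.refl
  ... | yes A′≡B′ | no  A≢B   = ⊥-elim (A≢B (insertAt-injective i false A′≡B′))
  ... | no  A′≢B′ | yes A≡B   = ⊥-elim (A′≢B′ (≡.cong (λ X → insertAt X i false) A≡B))

  monoMul-insertAt : (i : Fin (suc n)) (T U S : Subset n) →
    monoMul F (insertAt T i false) (insertAt U i false) (insertAt S i false) ≈ monoMul F T U S
  monoMul-insertAt i T U S with (insertAt T i false ∩ insertAt U i false) ≟S ⊥ | (T ∩ U) ≟S ⊥
  ... | no  _ | no _ = ≈-refl
  ... | yes _ | yes _ = reflexive (≡.cong₂ (λ k x → sgn F k * x) (inversions-insertAt F i T U)
      (≡.trans (≡.cong (λ X → e F X (insertAt S i false)) (zipWith-insertAt _ i false false T U)) (e-insertAt i (T ∪ U) S)))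
  ... | yes T′∩U′≡⊥ | no T∩U≢⊥ = ⊥-elim (T∩U≢⊥ (Equivalence.to (insertAt≡⊥⇔≡⊥ i (T ∩ U))
      (≡.trans (≡.sym (zipWith-insertAt _ i false false T U)) T′∩U′≡⊥)))
  ... | no T′∩U′≢⊥ | yes T∩U≡⊥ = ⊥-elim (T′∩U′≢⊥
      (≡.trans (zipWith-insertAt _ i false false T U) (Equivalence.from (insertAt≡⊥⇔≡⊥ i (T ∩ U)) T∩U≡⊥)))

  ∧-avoids : (i : Fin (suc n)) (a b : Ext F (suc n)) → Avoids i a → Avoids i b → Avoids i (a ⋀ b)
  ∧-avoids i a b a-avoids b-avoids S i∈S = ∧-vanishes a b S λ T U _ T∪U≡S →
    Sum⊎.map (a-avoids T) (b-avoids U) (x∈p∪q⁻ T U (≡.subst (i ∈_) (≡.sym T∪U≡S) i∈S))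

  restrict-∧ : (i : Fin (suc n)) (a b : Ext F (suc n)) → Avoids i b →
               restrict i (a ⋀ b) ≋ restrict i a ⋀ restrict i b
  restrict-∧ {n} i a b b-avoids S = begin
    (a ⋀ b) S′                                                    ≈⟨ ∧-apply a b S′ ⟩
    sumSubsets (suc n) (λ T → sumSubsets (suc n) (term T))        ≈⟨ sumSubsets-insertAt i (sumSubsets (suc n) ∘ term) ⟩
    sumSubsets n (λ T → sumSubsets (suc n) (term (ι T))) + sumSubsets n (λ T → sumSubsets (suc n) (term (ι₁ T)))
      ≈⟨ +-cong (sumSubsets-cong n λ T → sumSubsets-insertAt i (term (ι T)))
                (sumSubsets-zero n λ T → sumSubsets-zero (suc n) (i∈T T)) ⟩
    sumSubsets n (λ T → sumSubsets n (term (ι T) ∘ ι) + sumSubsets n (term (ι T) ∘ ι₁)) + 0#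
      ≈⟨ +-identityʳ _ ⟩
    sumSubsets n (λ T → sumSubsets n (term (ι T) ∘ ι) + sumSubsets n (term (ι T) ∘ ι₁))
      ≈⟨ sumSubsets-cong n (λ T → trans (+-congˡ (sumSubsets-zero n (i∈U T))) (+-identityʳ _)) ⟩
    sumSubsets n (λ T → sumSubsets n (term (ι T) ∘ ι))
      ≈⟨ sumSubsets-cong n (λ T → sumSubsets-cong n (λ U → *-congˡ (monoMul-insertAt i T U S))) ⟩
    sumSubsets n (λ T → sumSubsets n (λ U → (restrict i a T * restrict i b U) * monoMul F T U S))
      ≈⟨ ∧-apply (restrict i a) (restrict i b) S ⟨
    (restrict i a ⋀ restrict i b) S                               ∎
    where
    ι ι₁ : Subset n → Subset (suc n)
    ι  T = insertAt T i false
    ι₁ T = insertAt T i true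
    S′ = ι S
    term : Subset (suc n) → Subset (suc n) → Carrier
    term T U = (a T * b U) * monoMul F T U S′
    i∈U : ∀ T U → term (ι T) (ι₁ U) ≈ 0#
    i∈U T U = *-zero-outer (trans (*-congˡ (b-avoids (ι₁ U) (∈-insertAt-self i U))) (zeroʳ _))
    i∈T : ∀ T U → term (ι₁ T) U ≈ 0#
    i∈T T U with monoMul-view (ι₁ T) U S′
    ... | inj₁ m≈0 = trans (*-congˡ m≈0) (zeroʳ _)
    ... | inj₂ (_ , T∪U≡S′) = ⊥-elim (∉-insertAt-self i S
            (≡.subst (i ∈_) T∪U≡S′ (x∈p∪q⁺ (inj₁ (∈-insertAt-self i T)))))

  ∂term-insertAt-self : (i : Fin (suc n)) (C : Subset n) (U : Subset (suc n)) →
                        ∂term (insertAt C i false) i U ≈ 0#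
  ∂term-insertAt-self i C U with i ∈? insertAt C i false
  ... | yes i∈C′ = ⊥-elim (∉-insertAt-self i C i∈C′)
  ... | no  _    = ≈-refl

  ∂term-insertAt : (i : Fin (suc n)) (C : Subset n) (t : Fin n) (U : Subset n) →
                   ∂term (insertAt C i false) (punchIn i t) (insertAt U i false) ≈ ∂term C t U
  ∂term-insertAt i C t U with punchIn i t ∈? insertAt C i false | t ∈? C
  ... | no  _  | no  _   = ≈-refl
  ... | yes _  | yes _   = reflexive (≡.cong₂ (λ k x → sgn F k * x) (below-insertAt F i C t)
                             (≡.trans (≡.cong (λ X → e F X (insertAt U i false)) (insertAt-∖ i C t)) (e-insertAt i (C ∖ t) U)))
  ... | yes t∈ | no t∉C  = ⊥-elim (t∉C (Equivalence.to (punchIn∈insertAt⇔∈ i C false t) t∈))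
  ... | no t∉  | yes t∈C = ⊥-elim (t∉ (Equivalence.from (punchIn∈insertAt⇔∈ i C false t) t∈C))

  ∂e-avoids : (i : Fin (suc n)) (C : Subset n) → Avoids i (∂e F (insertAt C i false))
  ∂e-avoids i C U i∈U = trans (reflexive (∂e-apply (insertAt C i false) U)) (sum-zero +-commutativeMonoid _ term≈0)
    where
    term≈0 : ∀ s → ∂term (insertAt C i false) s U ≈ 0#
    term≈0 s with ∂term-view (insertAt C i false) s U
    ... | inj₁ t≈0 = t≈0
    ... | inj₂ (_ , C′∖s≡U) = ⊥-elim (∉-insertAt-self i C
            (p─q⊆p (insertAt C i false) ⁅ s ⁆ (≡.subst (i ∈_) (≡.sym C′∖s≡U) i∈U)))

  restrict-∂e : (i : Fin (suc n)) (C : Subset n) → restrict i (∂e F (insertAt C i false)) ≋ ∂e F C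
  restrict-∂e {n} i C U = begin
    ∂e F C′ (insertAt U i false)                                  ≡⟨ ∂e-apply C′ _ ⟩
    sum (λ s → ∂term C′ s (insertAt U i false))
      ≈⟨ sum-punchIn +-commutativeMonoid i (λ s → ∂term C′ s (insertAt U i false)) (∂term-insertAt-self i C _) ⟩
    sum (λ t → ∂term C′ (punchIn i t) (insertAt U i false))      ≈⟨ FSum.sum-cong-≋ (λ t → ∂term-insertAt i C t U) ⟩
    sum (λ t → ∂term C t U)                                       ≡⟨ ∂e-apply C U ⟨
    ∂e F C U                                                      ∎
    where C′ = insertAt C i false

  toExt-avoids : (i : Fin (suc n)) (v : Fin n → Carrier) → Avoids i (toExt F (embedV F i v))
  toExt-avoids i v U i∈U = trans (reflexive (toExt-apply w U)) (sum-zero +-commutativeMonoid _ term≈0)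
    where
    w = embedV F i v
    term≈0 : ∀ s → w s * e F ⁅ s ⁆ U ≈ 0#
    term≈0 s with toExt-term-view w s U
    ... | inj₁ t≈0 = t≈0
    ... | inj₂ ⁅s⁆≡U with ≡.refl ← x∈⁅y⁆⇒x≡y s (≡.subst (i ∈_) (≡.sym ⁅s⁆≡U) i∈U) =
      trans (*-congʳ (reflexive (VF.insertAt-lookup v i 0#))) (zeroˡ _)

  restrict-toExt : (i : Fin (suc n)) (v : Fin n → Carrier) → restrict i (toExt F (embedV F i v)) ≋ toExt F v
  restrict-toExt {n} i v U = begin
    toExt F w U′                                        ≡⟨ toExt-apply w U′ ⟩
    sum (λ s → w s * e F ⁅ s ⁆ U′)
      ≈⟨ sum-punchIn +-commutativeMonoid i (λ s → w s * e F ⁅ s ⁆ U′)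
           (trans (*-congʳ (reflexive (VF.insertAt-lookup v i 0#))) (zeroˡ _)) ⟩
    sum (λ t → w (punchIn i t) * e F ⁅ punchIn i t ⁆ U′)
      ≈⟨ FSum.sum-cong-≋ (λ t → reflexive (≡.cong₂ _*_ (VF.insertAt-punchIn v i 0# t)
           (≡.trans (≡.cong (λ X → e F X U′) (≡.sym (insertAt-⁅⁆ i t))) (e-insertAt i ⁅ t ⁆ U)))) ⟩
    sum (λ t → v t * e F ⁅ t ⁆ U)                       ≡⟨ toExt-apply v U ⟨
    toExt F v U                                         ∎
    where
    w = embedV F i v
    U′ = insertAt U i false

  extend : Fin (suc n) → Ext F n → Ext F (suc n)
  extend i x S = if lookup S i then 0# else x (removeAt S i)

  restrict-extend : (i : Fin (suc n)) (x : Ext F n) → restrict i (extend i x) ≋ x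
  restrict-extend i x T rewrite insertAt-lookup T i false | removeAt-insertAt T i false = ≈-refl

  extend-avoids : (i : Fin (suc n)) (x : Ext F n) → Avoids i (extend i x)
  extend-avoids i x U i∈U rewrite []=⇒lookup i∈U = ≈-refl

  ≋-by-restrict : (i : Fin (suc n)) {x y : Ext F (suc n)} → Avoids i x → Avoids i y →
                  restrict i x ≋ restrict i y → x ≋ y
  ≋-by-restrict i x-avoids y-avoids x≋y S with insertAt-view i S
  ... | inj₁ (T , ≡.refl) = x≋y T
  ... | inj₂ i∈S          = trans (x-avoids S i∈S) (sym (y-avoids S i∈S))

  extend-unique : (i : Fin (suc n)) (x : Ext F n) {y : Ext F (suc n)} → Avoids i y → x ≋ restrict i y → extend i x ≋ y
  extend-unique i x y-avoids x≋y = ≋-by-restrict i (extend-avoids i x) y-avoids (λ T → trans (restrict-extend i x T) (x≋y T))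

  extend-cong : (i : Fin (suc n)) {x y : Ext F n} → x ≋ y → extend i x ≋ extend i y
  extend-cong i {y = y} x≋y = extend-unique i _ (extend-avoids i y) (λ T → trans (x≋y T) (sym (restrict-extend i y T)))

  extend-zero : (i : Fin (suc n)) → extend i (zeroE F) ≋ zeroE F
  extend-zero i = extend-unique i (zeroE F) (λ _ _ → ≈-refl) (λ _ → ≈-refl)

  extend-+ : (i : Fin (suc n)) (x y : Ext F n) → extend i (_+E_ F x y) ≋ _+E_ F (extend i x) (extend i y)
  extend-+ i x y = extend-unique i _
    (λ U i∈U → trans (+-cong (extend-avoids i x U i∈U) (extend-avoids i y U i∈U)) (+-identityˡ 0#))
    (λ T → sym (+-cong (restrict-extend i x T) (restrict-extend i y T)))

  extend-sumE : ∀ {a} {A : Set a} (i : Fin (suc n)) (f : A → Ext F n) (xs : List A) →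
                extend i (sumE F (map f xs)) ≋ sumE F (map (extend i ∘ f) xs)
  extend-sumE i f []       = extend-zero i
  extend-sumE i f (x ∷ xs) S = trans (extend-+ i (f x) (sumE F (map f xs)) S) (+-congˡ (extend-sumE i f xs S))

  extend-∧ : (i : Fin (suc n)) (a b : Ext F n) → extend i (a ⋀ b) ≋ extend i a ⋀ extend i b
  extend-∧ i a b = extend-unique i (a ⋀ b) (∧-avoids i _ _ (extend-avoids i a) (extend-avoids i b)) λ T → begin
    (a ⋀ b) T                                              ≈⟨ ∧-cong (restrict-extend i a) (restrict-extend i b) T ⟨
    (restrict i (extend i a) ⋀ restrict i (extend i b)) T  ≈⟨ restrict-∧ i (extend i a) (extend i b) (extend-avoids i b) T ⟨
    restrict i (extend i a ⋀ extend i b) T                 ∎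

  extend-∂e : (i : Fin (suc n)) (C : Subset n) → extend i (∂e F C) ≋ ∂e F (insertAt C i false)
  extend-∂e i C = extend-unique i (∂e F C) (∂e-avoids i C) (λ T → sym (restrict-∂e i C T))

  extend-toExt : (i : Fin (suc n)) (v : Fin n → Carrier) → extend i (toExt F v) ≋ toExt F (embedV F i v)
  extend-toExt i v = extend-unique i (toExt F v) (toExt-avoids i v) (λ T → sym (restrict-toExt i v T))

  InIdeal-extend : (i : Fin (suc n)) {Circ : CircuitFamily (suc n)} {z : Ext F n} →
    InIdeal F (λ C → Circ (insertAt C i false)) z → InIdeal F Circ (extend i z)
  InIdeal-extend {n} i {z = z} (gens , circuits , z≋) = map lift gens , All.map⁺ circuits , λ S → begin
    extend i z S                                          ≈⟨ extend-cong i z≋ S ⟩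
    extend i (sumE F (map generator gens)) S              ≈⟨ extend-sumE i generator gens S ⟩
    sumE F (map (extend i ∘ generator) gens) S            ≈⟨ sumE-map-cong gens extend-generator S ⟩
    sumE F (map (generator ∘ lift) gens) S                ≡⟨ ≡.cong (λ xs → sumE F xs S) (map-∘ gens) ⟩
    sumE F (map generator (map lift gens)) S              ∎
    where
    generator : ∀ {m} → Ext F m × Subset m → Ext F m
    generator (g , C) = g ⋀ ∂e F C
    lift : Ext F n × Subset n → Ext F (suc n) × Subset (suc n)
    lift (g , C) = extend i g , insertAt C i false
    extend-generator : ∀ gC → extend i (generator gC) ≋ generator (lift gC)
    extend-generator (g , C) S = trans (extend-∧ i g (∂e F C) S) (∧-cong (λ _ → ≈-refl) (extend-∂e i C) S)

  extend-homogeneous : ∀ {p} (i : Fin (suc n)) (x : Ext F n) → HomogeneousOf F p x → HomogeneousOf F p (extend i x)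
  extend-homogeneous i x x-hom S ∣S∣≢p with insertAt-view i S
  ... | inj₁ (T , ≡.refl) = trans (restrict-extend i x T) (x-hom T (∣S∣≢p ∘ ≡.trans (∣insertAt-false∣ i T)))
  ... | inj₂ i∈S          = extend-avoids i x S i∈S

  extend-cocycle : (i : Fin (suc n)) {Circ : CircuitFamily (suc n)} (x : Ext F n) (v : Fin n → Carrier) →
    InIdeal F (λ C → Circ (insertAt C i false)) (x ⋀ toExt F v) →
    InIdeal F Circ (extend i x ⋀ toExt F (embedV F i v))
  extend-cocycle i x v cocycle = InIdeal-cong
    (λ S → trans (extend-∧ i x (toExt F v) S) (∧-cong (λ _ → ≈-refl) (extend-toExt i v) S))
    (InIdeal-extend i cocycle)

  restrict-coboundary : ∀ {Circ : CircuitFamily (suc n)} k {p} → (∀ C → Circ C → suc k < ∣ C ∣) → p ≤ k →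
    (i : Fin (suc n)) (x : Ext F n) (y : Ext F (suc n)) (v : Fin n → Carrier) →
    HomogeneousOf F p x → (∀ T → suc ∣ T ∣ ≢ p → y T ≈ 0#) →
    InIdeal F Circ (_+E_ F (extend i x) (-E_ F (y ⋀ toExt F (embedV F i v)))) →
    x ≋ restrict i y ⋀ toExt F v
  restrict-coboundary k {p} large p≤k i x y v x-hom y-hom coboundary S with ∣ S ∣ ℕ.≤? k
  ... | yes ∣S∣≤k = x∙y⁻¹≈ε⇒x≈y _ _ (begin
    x S + - (restrict i y ⋀ toExt F v) S
      ≈⟨ +-cong (restrict-extend i x S) (-‿cong (∧-cong (λ _ → ≈-refl) (restrict-toExt i v) S)) ⟨
    extend i x S′ + - (restrict i y ⋀ restrict i w) S
      ≈⟨ +-congˡ (-‿cong (restrict-∧ i y w (toExt-avoids i v) S)) ⟨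
    extend i x S′ + - (y ⋀ w) S′
      ≈⟨ InIdeal-vanishes-low k large coboundary S′ (ℕ.≤-trans (ℕ.≤-reflexive (∣insertAt-false∣ i S)) ∣S∣≤k) ⟩
    0# ∎)
    where
    S′ = insertAt S i false
    w  = toExt F (embedV F i v)
  ... | no  ∣S∣≰k = trans (x-hom S ∣S∣≢p) (sym (∧-homogeneous (restrict i y) (toExt F v)
                      (restrict-vanishes {P = λ d → suc d ≢ p} i y y-hom)
                      (toExt-homogeneous v) S ∣S∣≢p))
    where
    ∣S∣≢p : ∣ S ∣ ≢ p
    ∣S∣≢p ∣S∣≡p = ∣S∣≰k (≡.subst (_≤ k) (≡.sym ∣S∣≡p) p≤k)

corollary4p10 : ∀ {c ℓ} (F : Field c ℓ) (m : ℕ) (M : Matroid (suc m)) (k : ℕ) →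
    IsGeneric k M → (i0 : Fin (suc m)) → (p : ℕ) → p ≤ k →
    (v : Fin m → Field.Carrier F) →
    Resonant F (deletionCircuits M i0) p v →
    Resonant F (Matroid.IsCircuit M) p (embedV F i0 v)
corollary4p10 F m M k generic i0 p p≤k v (x , x-hom , cocycle , ¬coboundary) =
    extend F i0 x
  , extend-homogeneous F i0 x x-hom
  , extend-cocycle F i0 x v cocycle
  , λ (y , y-hom , coboundary) → ¬coboundary
      ( restrict F i0 y
      , restrict-vanishes F {P = λ d → suc d ≢ p} i0 y y-hom
      , ≋⇒InIdeal-difference F (restrict-coboundary F k generic p≤k i0 x y v x-hom y-hom coboundary))
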